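{- Let $\mathbf{K}$ be a class of Heyting algebras with involution. Then the following are equivalent: (1) there exists a common killer for the algebras in $\mathbf{K}$, i.e. a unary term $k(x)$ such that for all $\mathbf{A}\in\mathbf{K}$ and $a\in A$, $k^{\mathbf{A}}(a)=1$ if $a=1$ and $k^{\mathbf{A}}(a)=0$ if $a\ne 1$; (2) there exists a common discriminator for the algebras in $\mathbf{K}$, i.e. a ternary term $t(x,y,z)$ such that for all $\mathbf{A}\in\mathbf{K}$ and $a,b,c\in A$, $t^{\mathbf{A}}(a,b,c)=a$ if $a\neq b$ and $t^{\mathbf{A}}(a,b,c)=c$ if $a=b$.
   Context: A Heyting algebra with involution is an algebra $\langle A,\lor,\land,\to,\neg,\sim,0,1\rangle$ where $\langle A,\lor,\land,\to,\neg,0,1\rangle$ is a Heyting algebra ($a\to b=\sup\{x:a\land x\le b\}$, $\neg a=a\to 0$) and $\sim$ satisfies $\sim(a\lor b)=\sim a\land\sim b$ and $\sim\sim a=a$. Terms are built from variables using the operations $\lor,\land,\to,\neg,\sim,0,1$. -}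

module Defs where

open import Level using (Level; _⊔_) renaming (suc to lsuc)
open import Data.Nat using (ℕ)
open import Data.Fin using (Fin)
open import Relation.Binary.Lattice.Bundles using (HeytingAlgebra)
open import Relation.Binary.Core using (_Preserves_⟶_)

record HeytingAlgebraWithInvolution c ℓ₁ ℓ₂ : Set (lsuc (c ⊔ ℓ₁ ⊔ ℓ₂)) where
  field
    heytingAlgebra : HeytingAlgebra c ℓ₁ ℓ₂
  open HeytingAlgebra heytingAlgebra public
  field
    ∼_        : Carrier → Carrier
    ∼-cong    : ∼_ Preserves _≈_ ⟶ _≈_
    ∼-∨       : ∀ a b → ∼ (a ∨ b) ≈ ((∼ a) ∧ (∼ b))
    ∼-involutive : ∀ a → ∼ (∼ a) ≈ a

  ¬ₕ_ : Carrier → Carrier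
  ¬ₕ a = a ⇨ ⊥

data Term (n : ℕ) : Set where
  var  : Fin n → Term n
  _∨ₜ_ _∧ₜ_ _→ₜ_ : Term n → Term n → Term n
  ¬ₜ_ ∼ₜ_ : Term n → Term n
  0ₜ 1ₜ : Term n

module _ {c ℓ₁ ℓ₂} (A : HeytingAlgebraWithInvolution c ℓ₁ ℓ₂) where
  open HeytingAlgebraWithInvolution A

  ⟦_⟧ : ∀ {n} → Term n → (Fin n → Carrier) → Carrier
  ⟦ var i ⟧ ρ = ρ i
  ⟦ s ∨ₜ t ⟧ ρ = ⟦ s ⟧ ρ ∨ ⟦ t ⟧ ρ
  ⟦ s ∧ₜ t ⟧ ρ = ⟦ s ⟧ ρ ∧ ⟦ t ⟧ ρ
  ⟦ s →ₜ t ⟧ ρ = ⟦ s ⟧ ρ ⇨ ⟦ t ⟧ ρ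
  ⟦ ¬ₜ t ⟧ ρ = ¬ₕ (⟦ t ⟧ ρ)
  ⟦ ∼ₜ t ⟧ ρ = ∼ (⟦ t ⟧ ρ)
  ⟦ 0ₜ ⟧ ρ = ⊥
  ⟦ 1ₜ ⟧ ρ = ⊤

module _ {a} {X : Set a} where
  open import Data.Fin using (zero; suc)
  [_] : X → Fin 1 → X
  [ x ] _ = x

  [_,_,_] : X → X → X → Fin 3 → X
  [ x , y , z ] zero = x
  [ x , y , z ] (suc zero) = y
  [ x , y , z ] (suc (suc zero)) = z

module _ {c ℓ₁ ℓ₂ k} (K : HeytingAlgebraWithInvolution c ℓ₁ ℓ₂ → Set k) where
  open import Relation.Nullary using (¬_)
  open import Data.Product using (_×_)
  open HeytingAlgebraWithInvolution using (Carrier; _≈_; ⊤; ⊥)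

  IsCommonKiller : Term 1 → Set (lsuc (c ⊔ ℓ₁ ⊔ ℓ₂) ⊔ k)
  IsCommonKiller t = ∀ (A : HeytingAlgebraWithInvolution c ℓ₁ ℓ₂) → K A →
    ∀ (a : Carrier A) →
      (_≈_ A a (⊤ A) → _≈_ A (⟦ A ⟧ t [ a ]) (⊤ A)) ×
      (¬ (_≈_ A a (⊤ A)) → _≈_ A (⟦ A ⟧ t [ a ]) (⊥ A))

  IsCommonDiscriminator : Term 3 → Set (lsuc (c ⊔ ℓ₁ ⊔ ℓ₂) ⊔ k)
  IsCommonDiscriminator t = ∀ (A : HeytingAlgebraWithInvolution c ℓ₁ ℓ₂) → K A →
    ∀ (a b d : Carrier A) →
      (¬ (_≈_ A a b) → _≈_ A (⟦ A ⟧ t [ a , b , d ]) a) ×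
      (_≈_ A a b → _≈_ A (⟦ A ⟧ t [ a , b , d ]) d)

-- In a Heyting algebra x ⇌ y := (x ⇨ y) ∧ (y ⇨ x) equals 1 exactly when x = y,
-- and (u ∧ z) ∨ (¬u ∧ x) returns z when u = 1 and x when u = 0.  So a killer k
-- yields the discriminator (k(x ⇌ y) ∧ z) ∨ (¬k(x ⇌ y) ∧ x).  Conversely, from a
-- discriminator t the term ¬t(1, x, 0) is a killer: t(1, x, 0) is 0 when x = 1
-- and 1 otherwise.
module Submission where

open import Defs
open import Level using (Level)
open import Data.Product using (Σ; proj₁; proj₂; map)
open import Function.Base using (_∘_)
open import Function.Bundles using (_⇔_; mk⇔)
open import Data.Fin using (Fin; zero; suc)
open import Relation.Binary.PropositionalEquality as ≡ using (_≡_)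
open import Relation.Binary.Lattice.Bundles using (HeytingAlgebra)
import Relation.Binary.Lattice.Properties.HeytingAlgebra as HeytingAlgebraProperties
import Relation.Binary.Lattice.Properties.BoundedLattice as BoundedLatticeProperties
import Relation.Binary.Lattice.Properties.BoundedJoinSemilattice as BoundedJoinSemilatticeProperties
import Relation.Binary.Lattice.Properties.BoundedMeetSemilattice as BoundedMeetSemilatticeProperties
import Relation.Binary.Lattice.Properties.JoinSemilattice as JoinSemilatticeProperties
import Relation.Binary.Lattice.Properties.MeetSemilattice as MeetSemilatticeProperties
import Relation.Binary.Reasoning.Setoid as ≈-Reasoning

module HeytingAlgebraSelection {c ℓ₁ ℓ₂} (L : HeytingAlgebra c ℓ₁ ℓ₂) where
  open HeytingAlgebra L
  open HeytingAlgebraProperties L using (¬_; ⇨-cong; ⇨-unit; ⇨-eval)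
  open BoundedLatticeProperties boundedLattice using (∧-zeroˡ)
  open BoundedJoinSemilatticeProperties boundedJoinSemilattice
    using () renaming (identityˡ to ∨-identityˡ; identityʳ to ∨-identityʳ)
  open BoundedMeetSemilatticeProperties boundedMeetSemilattice
    using () renaming (identityˡ to ∧-identityˡ)
  open JoinSemilatticeProperties joinSemilattice using (∨-cong)
  open MeetSemilatticeProperties meetSemilattice using (∧-cong)

  infix 6 _⇌_
  _⇌_ : Carrier → Carrier → Carrier
  x ⇌ y = (x ⇨ y) ∧ (y ⇨ x)

  select : Carrier → Carrier → Carrier → Carrier
  select u z x = (u ∧ z) ∨ (¬ u ∧ x)

  ¬⊤≈⊥ : ¬ ⊤ ≈ ⊥
  ¬⊤≈⊥ = antisym (trans (∧-greatest refl (maximum _)) ⇨-eval) (minimum _)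

  ¬-≈⊤ : ∀ {u} → u ≈ ⊤ → ¬ u ≈ ⊥
  ¬-≈⊤ u≈⊤ = Eq.trans (⇨-cong u≈⊤ Eq.refl) ¬⊤≈⊥

  ¬-≈⊥ : ∀ {u} → u ≈ ⊥ → ¬ u ≈ ⊤
  ¬-≈⊥ u≈⊥ = Eq.trans (⇨-cong u≈⊥ Eq.refl) ⇨-unit

  ⊤≤x⇨y⇒x≤y : ∀ {x y} → ⊤ ≤ x ⇨ y → x ≤ y
  ⊤≤x⇨y⇒x≤y ⊤≤x⇨y = trans (∧-greatest (trans (maximum _) ⊤≤x⇨y) refl) ⇨-eval

  x≈y⇒x⇌y≈⊤ : ∀ {x y} → x ≈ y → x ⇌ y ≈ ⊤
  x≈y⇒x⇌y≈⊤ {x} {y} x≈y = begin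
    (x ⇨ y) ∧ (y ⇨ x)  ≈⟨ ∧-cong (⇨-cong x≈y Eq.refl) (⇨-cong Eq.refl x≈y) ⟩
    (y ⇨ y) ∧ (y ⇨ y)  ≈⟨ ∧-cong ⇨-unit ⇨-unit ⟩
    ⊤ ∧ ⊤              ≈⟨ ∧-identityˡ ⊤ ⟩
    ⊤                  ∎
    where open ≈-Reasoning setoid

  x⇌y≈⊤⇒x≈y : ∀ {x y} → x ⇌ y ≈ ⊤ → x ≈ y
  x⇌y≈⊤⇒x≈y x⇌y≈⊤ = antisym
    (⊤≤x⇨y⇒x≤y (trans (reflexive (Eq.sym x⇌y≈⊤)) (x∧y≤x _ _)))
    (⊤≤x⇨y⇒x≤y (trans (reflexive (Eq.sym x⇌y≈⊤)) (x∧y≤y _ _)))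

  select-≈⊤ : ∀ {u} z x → u ≈ ⊤ → select u z x ≈ z
  select-≈⊤ {u} z x u≈⊤ = begin
    (u ∧ z) ∨ (¬ u ∧ x)  ≈⟨ ∨-cong (∧-cong u≈⊤ Eq.refl) (∧-cong (¬-≈⊤ u≈⊤) Eq.refl) ⟩
    (⊤ ∧ z) ∨ (⊥ ∧ x)    ≈⟨ ∨-cong (∧-identityˡ z) (∧-zeroˡ x) ⟩
    z ∨ ⊥                ≈⟨ ∨-identityʳ z ⟩
    z                    ∎
    where open ≈-Reasoning setoid

  select-≈⊥ : ∀ {u} z x → u ≈ ⊥ → select u z x ≈ x
  select-≈⊥ {u} z x u≈⊥ = begin
    (u ∧ z) ∨ (¬ u ∧ x)  ≈⟨ ∨-cong (∧-cong u≈⊥ Eq.refl) (∧-cong (¬-≈⊥ u≈⊥) Eq.refl) ⟩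
    (⊥ ∧ z) ∨ (⊤ ∧ x)    ≈⟨ ∨-cong (∧-zeroˡ z) (∧-identityˡ x) ⟩
    ⊥ ∨ x                ≈⟨ ∨-identityˡ x ⟩
    x                    ∎
    where open ≈-Reasoning setoid

infixl 30 _[_]ₜ
_[_]ₜ : ∀ {m n} → Term m → (Fin m → Term n) → Term n
var i [ σ ]ₜ = σ i
(s ∨ₜ t) [ σ ]ₜ = s [ σ ]ₜ ∨ₜ t [ σ ]ₜ
(s ∧ₜ t) [ σ ]ₜ = s [ σ ]ₜ ∧ₜ t [ σ ]ₜ
(s →ₜ t) [ σ ]ₜ = s [ σ ]ₜ →ₜ t [ σ ]ₜ
(¬ₜ t) [ σ ]ₜ = ¬ₜ t [ σ ]ₜ
(∼ₜ t) [ σ ]ₜ = ∼ₜ t [ σ ]ₜ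
0ₜ [ σ ]ₜ = 0ₜ
1ₜ [ σ ]ₜ = 1ₜ

x₀ x₁ x₂ : Term 3
x₀ = var zero
x₁ = var (suc zero)
x₂ = var (suc (suc zero))

_⇌ₜ_ : ∀ {n} → Term n → Term n → Term n
s ⇌ₜ t = (s →ₜ t) ∧ₜ (t →ₜ s)

selectₜ : ∀ {n} → Term n → Term n → Term n → Term n
selectₜ u s t = (u ∧ₜ s) ∨ₜ ((¬ₜ u) ∧ₜ t)

discriminatorFromKiller : Term 1 → Term 3
discriminatorFromKiller k = selectₜ (k [ (λ _ → x₀ ⇌ₜ x₁) ]ₜ) x₂ x₀

killerFromDiscriminator : Term 3 → Term 1
killerFromDiscriminator t = ¬ₜ (t [ σ ]ₜ)
  where
  σ : Fin 3 → Term 1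
  σ zero = 1ₜ
  σ (suc zero) = var zero
  σ (suc (suc zero)) = 0ₜ

module _ {c ℓ₁ ℓ₂} (A : HeytingAlgebraWithInvolution c ℓ₁ ℓ₂) where
  open HeytingAlgebraWithInvolution A
  open HeytingAlgebraSelection heytingAlgebra

  ⟦[]ₜ⟧ : ∀ {m n} (t : Term m) {σ : Fin m → Term n} {ρ : Fin n → Carrier} {ρ′ : Fin m → Carrier} →
          (∀ i → ⟦ A ⟧ (σ i) ρ ≡ ρ′ i) → ⟦ A ⟧ (t [ σ ]ₜ) ρ ≡ ⟦ A ⟧ t ρ′
  ⟦[]ₜ⟧ (var i) σ≗ρ′ = σ≗ρ′ i
  ⟦[]ₜ⟧ (s ∨ₜ t) σ≗ρ′ = ≡.cong₂ _∨_ (⟦[]ₜ⟧ s σ≗ρ′) (⟦[]ₜ⟧ t σ≗ρ′)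
  ⟦[]ₜ⟧ (s ∧ₜ t) σ≗ρ′ = ≡.cong₂ _∧_ (⟦[]ₜ⟧ s σ≗ρ′) (⟦[]ₜ⟧ t σ≗ρ′)
  ⟦[]ₜ⟧ (s →ₜ t) σ≗ρ′ = ≡.cong₂ _⇨_ (⟦[]ₜ⟧ s σ≗ρ′) (⟦[]ₜ⟧ t σ≗ρ′)
  ⟦[]ₜ⟧ (¬ₜ t) σ≗ρ′ = ≡.cong ¬ₕ_ (⟦[]ₜ⟧ t σ≗ρ′)
  ⟦[]ₜ⟧ (∼ₜ t) σ≗ρ′ = ≡.cong ∼_ (⟦[]ₜ⟧ t σ≗ρ′)
  ⟦[]ₜ⟧ 0ₜ σ≗ρ′ = ≡.refl
  ⟦[]ₜ⟧ 1ₜ σ≗ρ′ = ≡.refl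

  ⟦discriminatorFromKiller⟧ : ∀ κ a b d →
    ⟦ A ⟧ (discriminatorFromKiller κ) [ a , b , d ] ≡ select (⟦ A ⟧ κ [ a ⇌ b ]) d a
  ⟦discriminatorFromKiller⟧ κ a b d =
    ≡.cong (λ u → select u d a) (⟦[]ₜ⟧ κ (λ _ → ≡.refl))

  ⟦killerFromDiscriminator⟧ : ∀ t a →
    ⟦ A ⟧ (killerFromDiscriminator t) [ a ] ≡ ¬ₕ (⟦ A ⟧ t [ ⊤ , a , ⊥ ])
  ⟦killerFromDiscriminator⟧ t a = ≡.cong ¬ₕ_ (⟦[]ₜ⟧ t
    λ { zero → ≡.refl ; (suc zero) → ≡.refl ; (suc (suc zero)) → ≡.refl })

module _ {c ℓ₁ ℓ₂ k} (K : HeytingAlgebraWithInvolution c ℓ₁ ℓ₂ → Set k) where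
  open import Data.Product using (_,_)

  killer⇒discriminator : ∀ {κ} → IsCommonKiller K κ → IsCommonDiscriminator K (discriminatorFromKiller κ)
  killer⇒discriminator {κ} isKiller A A∈K a b d =
    (λ a≉b → Eq.trans (Eq.reflexive (⟦discriminatorFromKiller⟧ A κ a b d))
                      (select-≈⊥ d a (isKiller A A∈K (a ⇌ b) .proj₂ (a≉b ∘ x⇌y≈⊤⇒x≈y)))) ,
    (λ a≈b → Eq.trans (Eq.reflexive (⟦discriminatorFromKiller⟧ A κ a b d))
                      (select-≈⊤ d a (isKiller A A∈K (a ⇌ b) .proj₁ (x≈y⇒x⇌y≈⊤ a≈b))))
    where
    open HeytingAlgebraWithInvolution A
    open HeytingAlgebraSelection heytingAlgebra

  discriminator⇒killer : ∀ {t} → IsCommonDiscriminator K t → IsCommonKiller K (killerFromDiscriminator t)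
  discriminator⇒killer {t} isDiscriminator A A∈K a =
    (λ a≈⊤ → Eq.trans (Eq.reflexive (⟦killerFromDiscriminator⟧ A t a))
                      (¬-≈⊥ (isDiscriminator A A∈K ⊤ a ⊥ .proj₂ (Eq.sym a≈⊤)))) ,
    (λ a≉⊤ → Eq.trans (Eq.reflexive (⟦killerFromDiscriminator⟧ A t a))
                      (¬-≈⊤ (isDiscriminator A A∈K ⊤ a ⊥ .proj₁ (a≉⊤ ∘ Eq.sym))))
    where
    open HeytingAlgebraWithInvolution A
    open HeytingAlgebraSelection heytingAlgebra

lemma4p2 : ∀ {c ℓ₁ ℓ₂ k : Level} (K : HeytingAlgebraWithInvolution c ℓ₁ ℓ₂ → Set k) →
    (Σ (Term 1) (IsCommonKiller K)) ⇔ (Σ (Term 3) (IsCommonDiscriminator K))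
lemma4p2 K = mk⇔ (map discriminatorFromKiller (λ {κ} → killer⇒discriminator K {κ}))
                 (map killerFromDiscriminator (λ {t} → discriminator⇒killer K {t}))
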